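{- Let $M=x^2+x+1\in\mathbb{F}_2[x]$, $a,b\ge2$, and $A=1+M^a(M+1)^b$. Then: (1) if $a+b=2^r$ with $r\ge1$, then $\ell_A=b+1$; (2) if $a+b=2^r u$ with $u\ge3$ odd and $r\ge1$, and $w$ is the least positive integer with $u-1<2^w$, then $\ell_A=b+2^r(2^w-u)+1$; (3) if $a+b=2^t+1$ with $t\ge1$, then $\ell_A=a+2b-1$; (4) if $a+b=2v+1$ where $v$ is not a power of $2$, and $r$ is the least positive integer with $2v<2^r$, then $\ell_A=b+2^r-2v$.
   Context: For nonzero $A\in\mathbb{F}_2[x]$, the Collatz transformations are: $A_0=A$, and for $k\ge0$, $A_{2k+1}=A_{2k}/(x^{a_{2k}}(x+1)^{b_{2k}})$ where $a_{2k},b_{2k}$ are the multiplicities of $x$ and $x+1$ in $A_{2k}$, and $A_{2k+2}=1+MA_{2k+1}$. The length $\ell_A$ is $1+\min\{k\ge0: A_{2k+1}=1\}$, i.e. the number of terms of the sequence $A_1,A_3,A_5,\dots$ up to and including its first term equal to $1$. -}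

module Defs where

open import Data.Bool using (Bool; true; false; if_then_else_; _xor_; not)
open import Data.List using (List; []; _∷_; length)
open import Data.Nat using (ℕ; zero; suc; _∸_; _<_; _≥_)
open import Data.Product using (_×_)
open import Relation.Binary.PropositionalEquality using (_≡_; _≢_)

-- Polynomials over F₂ as coefficient lists, lowest degree first.
-- All operations below return the canonical form (no trailing 'false'),
-- so equality of polynomials is propositional equality of canonical lists.
Poly : Set
Poly = List Bool

trim : Poly → Poly
trim [] = []
trim (c ∷ p) with trim p
... | [] = if c then true ∷ [] else []
... | q@(_ ∷ _) = c ∷ q

zeroP : Poly
zeroP = []

oneP : Poly
oneP = true ∷ []

addRaw : Poly → Poly → Poly
addRaw [] q = q
addRaw p [] = p
addRaw (c ∷ p) (d ∷ q) = (c xor d) ∷ addRaw p q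

_⊕_ : Poly → Poly → Poly
p ⊕ q = trim (addRaw p q)

mulX : Poly → Poly
mulX p with trim p
... | [] = []
... | q@(_ ∷ _) = false ∷ q

_⊗_ : Poly → Poly → Poly
[] ⊗ q = []
(c ∷ p) ⊗ q = (if c then trim q else []) ⊕ mulX (p ⊗ q)

_^P_ : Poly → ℕ → Poly
p ^P zero = oneP
p ^P suc n = p ⊗ (p ^P n)

M : Poly
M = true ∷ true ∷ true ∷ []

stripX : Poly → Poly
stripX [] = []
stripX (false ∷ p) = stripX p
stripX (true ∷ p) = trim (true ∷ p)

evalOne : Poly → Bool
evalOne [] = false
evalOne (c ∷ p) = c xor evalOne p

-- exact division by (x+1) of a polynomial with p(1) = 0:
-- if p = (1+x) q then q_i = p_0 + ... + p_i ; the last prefix sum (= p(1)) is dropped.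
prefixXor : Bool → Poly → Poly
prefixXor acc [] = []
prefixXor acc (c ∷ []) = []
prefixXor acc (c ∷ p@(_ ∷ _)) = (acc xor c) ∷ prefixXor (acc xor c) p

divX1 : Poly → Poly
divX1 p = trim (prefixXor false p)

-- remove all factors (x+1); fuel = number of coefficients bounds the multiplicity
stripX1' : ℕ → Poly → Poly
stripX1' zero p = p
stripX1' (suc n) [] = []
stripX1' (suc n) p@(_ ∷ _) = if evalOne p then p else stripX1' n (divX1 p)

stripX1 : Poly → Poly
stripX1 p = stripX1' (length p) p

-- A ↦ A / (x^a (x+1)^b), a, b the multiplicities of x and x+1 in A
oddPart : Poly → Poly
oddPart p = stripX1 (stripX (trim p))

-- oddSeq A k = A_{2k+1}
oddSeq : Poly → ℕ → Poly
oddSeq A zero = oddPart A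
oddSeq A (suc k) = oddPart (oneP ⊕ (M ⊗ oddSeq A k))

LengthIs : Poly → ℕ → Set
LengthIs A n =
  n ≥ 1 × oddSeq A (n ∸ 1) ≡ oneP × (∀ j → j < n ∸ 1 → oddSeq A j ≢ oneP)

Apoly : ℕ → ℕ → Poly
Apoly a b = oneP ⊕ ((M ^P a) ⊗ ((M ⊕ oneP) ^P b))

{-# OPTIONS --safe #-}
-- Write N = M + 1 = x(x+1), G s t W = 1 + Mˢ Nᵗ W and Geom n = (Mⁿ + 1)/N = 1 + M + … + Mⁿ⁻¹.
-- For t ≥ 1, G s t W is prime to N and 1 + M·G s t W = N·G (s+1) (t-1) W, so starting from
-- A = G a b 1 the sequence A₁, A₃, … runs through G (a+i) (b-i) 1 and after b steps reaches the
-- odd part of N(1 + M^(a+b)).  If a + b = 2ʳu with u odd, Frobenius gives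
-- 1 + M^(a+b) = (N·Geom u)^(2ʳ), so the next term is Geom u ^ 2ʳ.  For odd m = 1 + 2ʲm′ (j ≥ 1,
-- m′ + 1 = 2ⁱm″) the same computation writes Geom m ^ 2ᵉ = G 2ᵉ t (Geom m′ ^ 2^(j+e)) with
-- t = (2ʲ - 1)2ᵉ, and t steps later the sequence is at Geom m″ ^ 2^(i+j+e).  Each step raises
-- 2ᵉm by exactly one, and the sequence reaches 1 = Geom 1 ^ 2ᵉ when 2ᵉm becomes the least power
-- of two T ≥ a + b.  Hence ℓ_A = b + (T - (a + b)) + 1 = T - a + 1, and the four cases only
-- identify T.

module Submission where

open import Defs
open import Level using (0ℓ)
open import Algebra.Bundles using (CommutativeMonoid; CommutativeRing; CommutativeSemiring)
open import Algebra.Structures using (IsCommutativeMonoid)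
open import Data.Bool using (Bool; true; false; if_then_else_; not; _xor_; _∧_)
open import Data.Bool.Properties
  using (not-involutive; xor-comm; xor-assoc; xor-identityʳ; xor-same; ∧-zeroʳ; ∧-distribʳ-xor; xor-∧-commutativeRing)
open import Data.List using ([]; _∷_; length)
open import Data.Maybe using (nothing)
open import Data.Nat using (ℕ; zero; suc; _+_; _*_; _∸_; _^_; _≤_; _<_; _<?_; z≤n; s≤s; s≤s⁻¹; NonZero)
open import Data.Nat.Divisibility using (_∣_)
open import Data.Nat.Induction using (<-rec)
open import Data.Nat.GeneralisedArithmetic using (fold; iterate; iterate-is-fold)
open import Data.Nat.Properties
open import Data.Nat.Tactic.RingSolver using (solve-∀)
open import Data.Product using (_×_; _,_; proj₁; ∃; ∃₂)
open import Data.Sum using (_⊎_; inj₁; inj₂)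
open import Relation.Nullary using (¬_; yes; no; contradiction)
open import Relation.Binary.Bundles using (Setoid)
open import Relation.Binary.Structures using (IsEquivalence)
open import Relation.Binary.PropositionalEquality
import Algebra.Properties.CommutativeSemigroup as CommSemigroupProperties
import Relation.Binary.Reasoning.Setoid as SetoidReasoning

open CommSemigroupProperties (CommutativeRing.+-commutativeSemigroup xor-∧-commutativeRing)
  using () renaming (interchange to xor-interchange)

mersenne : ℕ → ℕ
mersenne zero = zero
mersenne (suc i) = suc (2 * mersenne i)

suc-mersenne : ∀ i → suc (mersenne i) ≡ 2 ^ i
suc-mersenne zero = refl
suc-mersenne (suc i) = trans (sym (*-suc 2 (mersenne i))) (cong (2 *_) (suc-mersenne i))

Odd : ℕ → Set
Odd m = ∃ λ k → m ≡ suc (2 * k)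

parity : ∀ n → (∃ λ k → n ≡ 2 * k) ⊎ Odd n
parity zero = inj₁ (0 , refl)
parity (suc n) with parity n
... | inj₁ (k , refl) = inj₂ (k , refl)
... | inj₂ (k , refl) = inj₁ (suc k , sym (*-suc 2 k))

2^*odd : ∀ n → ∃₂ λ j m → Odd m × suc n ≡ 2 ^ j * m
2^*odd = <-rec P go
  where
  P : ℕ → Set
  P n = ∃₂ λ j m → Odd m × suc n ≡ 2 ^ j * m
  go : ∀ n → (∀ {k} → k < n → P k) → P n
  go n rec with parity n
  ... | inj₁ (k , refl) = 0 , suc (2 * k) , (k , refl) , sym (+-identityʳ _)
  ... | inj₂ (k , refl) with rec {k} (s≤s (m≤m+n k (k + 0)))
  ...   | j , m , m-odd , suc-k≡ = suc j , m , m-odd ,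
          trans (sym (*-suc 2 k)) (trans (cong (2 *_) suc-k≡) (sym (*-assoc 2 (2 ^ j) m)))

2*suc≡2^suc*odd : ∀ n → ∃₂ λ j m → Odd m × 2 * suc n ≡ 2 ^ suc j * m
2*suc≡2^suc*odd n with 2^*odd n
... | j , m , m-odd , suc-n≡ = j , m , m-odd , trans (cong (2 *_) suc-n≡) (sym (*-assoc 2 (2 ^ j) m))

2^-cancel-< : ∀ {m n} → 2 ^ m < 2 ^ n → m < n
2^-cancel-< {m} {n} 2^m<2^n with m <? n
... | yes m<n = m<n
... | no m≮n = contradiction (^-monoʳ-≤ 2 (≮⇒≥ m≮n)) (<⇒≱ 2^m<2^n)

2^*-suc-≤ : ∀ a b c .{{_ : NonZero c}} → 2 ^ a * c < 2 ^ b → 2 ^ a * suc c ≤ 2 ^ b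
2^*-suc-≤ a b c lt = subst (2 ^ a * suc c ≤_) (sym 2^b≡) (*-monoʳ-≤ (2 ^ a) c<2^[b∸a])
  where
  a<b : a < b
  a<b = 2^-cancel-< (≤-<-trans (m≤m*n (2 ^ a) c) lt)
  2^b≡ : 2 ^ b ≡ 2 ^ a * 2 ^ (b ∸ a)
  2^b≡ = trans (cong (2 ^_) (sym (m+[n∸m]≡n (<⇒≤ a<b)))) (^-distribˡ-+-* 2 a (b ∸ a))
  c<2^[b∸a] : c < 2 ^ (b ∸ a)
  c<2^[b∸a] = *-cancelˡ-< (2 ^ a) c (2 ^ (b ∸ a)) (subst (2 ^ a * c <_) 2^b≡ lt)

∸-split : ∀ n a t → a + t ≤ n → n ∸ a ≡ t + (n ∸ (a + t))
∸-split n a t a+t≤n = sym (trans (cong (t +_) (sym (∸-+-assoc n a t)))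
  (m+[n∸m]≡n (subst (_≤ n ∸ a) (m+n∸m≡n a t) (∸-monoˡ-≤ a a+t≤n))))

2^[i+n]*m≡2^n*[2^i*m] : ∀ i n m → 2 ^ (i + n) * m ≡ 2 ^ n * (2 ^ i * m)
2^[i+n]*m≡2^n*[2^i*m] i n m =
  trans (cong (_* m) (trans (^-distribˡ-+-* 2 i n) (*-comm (2 ^ i) (2 ^ n)))) (*-assoc (2 ^ n) (2 ^ i) m)

2^[j+e]*suc-m : ∀ j e m → 2 ^ (j + e) * suc m ≡ 2 ^ e * suc (2 ^ j * m) + mersenne j * 2 ^ e
2^[j+e]*suc-m j e m = begin
  2 ^ (j + e) * suc m                        ≡⟨ cong (_* suc m) (^-distribˡ-+-* 2 j e) ⟩
  2 ^ j * 2 ^ e * suc m                      ≡⟨ cong (λ p → p * 2 ^ e * suc m) (suc-mersenne j) ⟨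
  suc μ * 2 ^ e * suc m                      ≡⟨ expand μ (2 ^ e) m ⟩
  2 ^ e * suc (suc μ * m) + μ * 2 ^ e        ≡⟨ cong (λ p → 2 ^ e * suc (p * m) + μ * 2 ^ e) (suc-mersenne j) ⟩
  2 ^ e * suc (2 ^ j * m) + mersenne j * 2 ^ e ∎
  where
  open ≡-Reasoning
  μ = mersenne j
  expand : ∀ μ K m → suc μ * K * suc m ≡ K * suc (suc μ * m) + μ * K
  expand = solve-∀

odd-part-of-suc-< : ∀ i j m m′ .{{_ : NonZero m}} → 1 ≤ j → suc m ≡ 2 ^ i * m′ → m′ < suc (2 ^ j * m)
odd-part-of-suc-< i j m m′ 1≤j suc-m≡ =
  s≤s (≤-trans m′≤suc-m (subst (suc m ≤_) (*-comm m (2 ^ j)) (m<m*n m (2 ^ j) 1<2^j)))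
  where
  m′≤suc-m : m′ ≤ suc m
  m′≤suc-m = subst (m′ ≤_) (sym suc-m≡) (m≤n*m m′ (2 ^ i) {{m^n≢0 2 i}})
  1<2^j : 1 < 2 ^ j
  1<2^j = ^-monoʳ-< 2 (s≤s (s≤s z≤n)) 1≤j

least-2^-exceeding-≤-2* : ∀ n w → 1 ≤ n → 1 ≤ w → (∀ w′ → 1 ≤ w′ → n < 2 ^ w′ → w ≤ w′) → 2 ^ w ≤ 2 * n
least-2^-exceeding-≤-2* n (suc zero) 1≤n _ _ = *-monoʳ-≤ 2 1≤n
least-2^-exceeding-≤-2* n (suc (suc w)) _ _ least with n <? 2 ^ suc w
... | yes n<2^[1+w] = contradiction (least (suc w) (s≤s z≤n) n<2^[1+w]) 1+n≰n
... | no n≮2^[1+w] = *-monoʳ-≤ 2 (≮⇒≥ n≮2^[1+w])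

coeff : Poly → ℕ → Bool
coeff [] i = false
coeff (c ∷ p) zero = c
coeff (c ∷ p) (suc i) = coeff p i

-- Polynomials are compared coefficientwise, i.e. up to trailing zeros; the untrimmed operations
-- _⊞_ and _⊠_ below are lawful for this equality, and ≈⇒trim≡ returns to canonical forms.
infix 4 _≈_
record _≈_ (p q : Poly) : Set where
  constructor mk≈
  field coeff-≡ : ∀ i → coeff p i ≡ coeff q i
open _≈_

≈-refl : ∀ {p} → p ≈ p
≈-refl = mk≈ λ i → refl

≈-sym : ∀ {p q} → p ≈ q → q ≈ p
≈-sym h = mk≈ λ i → sym (coeff-≡ h i)

≈-trans : ∀ {p q r} → p ≈ q → q ≈ r → p ≈ r
≈-trans h g = mk≈ λ i → trans (coeff-≡ h i) (coeff-≡ g i)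

≡⇒≈ : ∀ {p q} → p ≡ q → p ≈ q
≡⇒≈ refl = ≈-refl

≈-isEquivalence : IsEquivalence _≈_
≈-isEquivalence = record { refl = ≈-refl ; sym = ≈-sym ; trans = ≈-trans }

≈-setoid : Setoid 0ℓ 0ℓ
≈-setoid = record { isEquivalence = ≈-isEquivalence }

module ≈-Reasoning = SetoidReasoning ≈-setoid

∷-cong : ∀ {c p q} → p ≈ q → c ∷ p ≈ c ∷ q
∷-cong h = mk≈ λ { zero → refl ; (suc i) → coeff-≡ h i }

∷-≈-tail : ∀ {c d p q} → c ∷ p ≈ d ∷ q → p ≈ q
∷-≈-tail h = mk≈ λ i → coeff-≡ h (suc i)

[]≈∷-tail : ∀ {c p} → [] ≈ c ∷ p → [] ≈ p
[]≈∷-tail h = mk≈ λ i → coeff-≡ h (suc i)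

∷≈[]-tail : ∀ {c p} → c ∷ p ≈ [] → p ≈ []
∷≈[]-tail h = mk≈ λ i → coeff-≡ h (suc i)

false∷-≈[] : ∀ {p} → p ≈ [] → false ∷ p ≈ []
false∷-≈[] h = mk≈ λ { zero → refl ; (suc i) → coeff-≡ h i }

trimCons : Bool → Poly → Poly
trimCons c [] = if c then true ∷ [] else []
trimCons c q@(_ ∷ _) = c ∷ q

trim-∷ : ∀ c p → trim (c ∷ p) ≡ trimCons c (trim p)
trim-∷ c p with trim p
... | [] = refl
... | _ ∷ _ = refl

trimCons-≈ : ∀ c q → trimCons c q ≈ c ∷ q
trimCons-≈ false [] = mk≈ λ { zero → refl ; (suc i) → refl }
trimCons-≈ true [] = ≈-refl
trimCons-≈ c (_ ∷ _) = ≈-refl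

trim-≈ : ∀ p → trim p ≈ p
trim-≈ [] = ≈-refl
trim-≈ (c ∷ p) = ≈-trans (≡⇒≈ (trim-∷ c p)) (≈-trans (trimCons-≈ c (trim p)) (∷-cong (trim-≈ p)))

≈[]⇒trim≡[] : ∀ p → p ≈ [] → trim p ≡ []
≈[]⇒trim≡[] [] h = refl
≈[]⇒trim≡[] (c ∷ p) h
  rewrite trim-∷ c p | ≈[]⇒trim≡[] p (∷≈[]-tail h) | coeff-≡ h zero = refl

≈⇒trim≡ : ∀ {p q} → p ≈ q → trim p ≡ trim q
≈⇒trim≡ {[]} {q} h = sym (≈[]⇒trim≡[] q (≈-sym h))
≈⇒trim≡ {c ∷ p} {[]} h = ≈[]⇒trim≡[] (c ∷ p) h
≈⇒trim≡ {c ∷ p} {d ∷ q} h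
  rewrite trim-∷ c p | trim-∷ d q | coeff-≡ h zero | ≈⇒trim≡ (∷-≈-tail h) = refl

trim-idem : ∀ p → trim (trim p) ≡ trim p
trim-idem p = ≈⇒trim≡ (trim-≈ p)

infixl 6 _⊞_
infixl 7 _⊠_

_⊞_ : Poly → Poly → Poly
_⊞_ = addRaw

scale : Bool → Poly → Poly
scale c q = if c then q else []

_⊠_ : Poly → Poly → Poly
[] ⊠ q = []
(c ∷ p) ⊠ q = scale c q ⊞ (false ∷ p ⊠ q)

one : Poly
one = true ∷ []

coeff-⊞ : ∀ p q i → coeff (p ⊞ q) i ≡ coeff p i xor coeff q i
coeff-⊞ [] q i = refl
coeff-⊞ (c ∷ p) [] i = sym (xor-identityʳ _)
coeff-⊞ (c ∷ p) (d ∷ q) zero = refl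
coeff-⊞ (c ∷ p) (d ∷ q) (suc i) = coeff-⊞ p q i

⊞-cong : ∀ {p p′ q q′} → p ≈ p′ → q ≈ q′ → p ⊞ q ≈ p′ ⊞ q′
⊞-cong {p} {p′} {q} {q′} h g = mk≈ λ i → trans (coeff-⊞ p q i)
  (trans (cong₂ _xor_ (coeff-≡ h i) (coeff-≡ g i)) (sym (coeff-⊞ p′ q′ i)))

⊞-congˡ : ∀ p {q q′} → q ≈ q′ → p ⊞ q ≈ p ⊞ q′
⊞-congˡ p h = ⊞-cong (≈-refl {p}) h

⊞-comm : ∀ p q → p ⊞ q ≈ q ⊞ p
⊞-comm p q = mk≈ λ i → trans (coeff-⊞ p q i)
  (trans (xor-comm (coeff p i) (coeff q i)) (sym (coeff-⊞ q p i)))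

⊞-assoc : ∀ p q r → (p ⊞ q) ⊞ r ≈ p ⊞ (q ⊞ r)
⊞-assoc p q r = mk≈ λ i → begin
  coeff ((p ⊞ q) ⊞ r) i
    ≡⟨ trans (coeff-⊞ (p ⊞ q) r i) (cong (_xor coeff r i) (coeff-⊞ p q i)) ⟩
  (coeff p i xor coeff q i) xor coeff r i
    ≡⟨ xor-assoc (coeff p i) (coeff q i) (coeff r i) ⟩
  coeff p i xor (coeff q i xor coeff r i)
    ≡⟨ trans (coeff-⊞ p (q ⊞ r) i) (cong (coeff p i xor_) (coeff-⊞ q r i)) ⟨
  coeff (p ⊞ (q ⊞ r)) i
    ∎
  where open ≡-Reasoning

⊞-identityʳ : ∀ p → p ⊞ [] ≈ p
⊞-identityʳ p = mk≈ λ i → trans (coeff-⊞ p [] i) (xor-identityʳ _)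

⊞-self : ∀ p → p ⊞ p ≈ []
⊞-self p = mk≈ λ i → trans (coeff-⊞ p p i) (xor-same (coeff p i))

⊞-isCommutativeMonoid : IsCommutativeMonoid _≈_ _⊞_ []
⊞-isCommutativeMonoid = record
  { isMonoid = record
    { isSemigroup = record
      { isMagma = record { isEquivalence = ≈-isEquivalence ; ∙-cong = ⊞-cong }
      ; assoc = ⊞-assoc }
    ; identity = (λ p → ≈-refl) , ⊞-identityʳ }
  ; comm = ⊞-comm }

⊞-commutativeMonoid : CommutativeMonoid 0ℓ 0ℓ
⊞-commutativeMonoid = record { isCommutativeMonoid = ⊞-isCommutativeMonoid }

open CommSemigroupProperties (CommutativeMonoid.commutativeSemigroup ⊞-commutativeMonoid)
  using () renaming (interchange to ⊞-interchange)

⊞-cancel : ∀ p q → p ⊞ q ≈ [] → p ≈ q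
⊞-cancel p q h = begin
  p             ≈⟨ ⊞-identityʳ p ⟨
  p ⊞ []        ≈⟨ ⊞-congˡ p (⊞-self q) ⟨
  p ⊞ (q ⊞ q)   ≈⟨ ⊞-assoc p q q ⟨
  (p ⊞ q) ⊞ q   ≈⟨ ⊞-cong h ≈-refl ⟩
  q             ∎
  where open ≈-Reasoning

⊞-self-cancelˡ : ∀ p q → p ⊞ (p ⊞ q) ≈ q
⊞-self-cancelˡ p q = ≈-trans (≈-sym (⊞-assoc p p q)) (⊞-cong (⊞-self p) (≈-refl {q}))

scale-cong : ∀ c {q q′} → q ≈ q′ → scale c q ≈ scale c q′
scale-cong false h = ≈-refl
scale-cong true h = h

scale-xor : ∀ c c′ q → scale (c xor c′) q ≈ scale c q ⊞ scale c′ q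
scale-xor false c′ q = ≈-refl
scale-xor true false q = ≈-sym (⊞-identityʳ q)
scale-xor true true q = ≈-sym (⊞-self q)

scale-[] : ∀ c → scale c [] ≡ []
scale-[] false = refl
scale-[] true = refl

⊠-congˡ : ∀ p {q q′} → q ≈ q′ → p ⊠ q ≈ p ⊠ q′
⊠-congˡ [] h = ≈-refl
⊠-congˡ (c ∷ p) h = ⊞-cong (scale-cong c h) (∷-cong (⊠-congˡ p h))

⊠-zeroʳ : ∀ p → p ⊠ [] ≈ []
⊠-zeroʳ [] = ≈-refl
⊠-zeroʳ (c ∷ p) rewrite scale-[] c = false∷-≈[] (⊠-zeroʳ p)

⊠-distribʳ : ∀ q p p′ → (p ⊞ p′) ⊠ q ≈ p ⊠ q ⊞ p′ ⊠ q
⊠-distribʳ q [] p′ = ≈-refl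
⊠-distribʳ q (c ∷ p) [] = ≈-sym (⊞-identityʳ _)
⊠-distribʳ q (c ∷ p) (c′ ∷ p′) = begin
  scale (c xor c′) q ⊞ (false ∷ (p ⊞ p′) ⊠ q)
    ≈⟨ ⊞-cong (scale-xor c c′ q) (∷-cong (⊠-distribʳ q p p′)) ⟩
  (scale c q ⊞ scale c′ q) ⊞ ((false ∷ p ⊠ q) ⊞ (false ∷ p′ ⊠ q))
    ≈⟨ ⊞-interchange (scale c q) (scale c′ q) _ _ ⟩
  (c ∷ p) ⊠ q ⊞ (c′ ∷ p′) ⊠ q ∎
  where open ≈-Reasoning

⊠-distribˡ : ∀ p q q′ → p ⊠ (q ⊞ q′) ≈ p ⊠ q ⊞ p ⊠ q′
⊠-distribˡ [] q q′ = ≈-refl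
⊠-distribˡ (false ∷ p) q q′ = ∷-cong (⊠-distribˡ p q q′)
⊠-distribˡ (true ∷ p) q q′ = begin
  (q ⊞ q′) ⊞ (false ∷ p ⊠ (q ⊞ q′))
    ≈⟨ ⊞-congˡ (q ⊞ q′) (∷-cong (⊠-distribˡ p q q′)) ⟩
  (q ⊞ q′) ⊞ ((false ∷ p ⊠ q) ⊞ (false ∷ p ⊠ q′))
    ≈⟨ ⊞-interchange q q′ _ _ ⟩
  (true ∷ p) ⊠ q ⊞ (true ∷ p) ⊠ q′ ∎
  where open ≈-Reasoning

⊠-false∷ : ∀ p q → p ⊠ (false ∷ q) ≈ false ∷ p ⊠ q
⊠-false∷ [] q = mk≈ λ { zero → refl ; (suc i) → refl }
⊠-false∷ (false ∷ p) q = ∷-cong (⊠-false∷ p q)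
⊠-false∷ (true ∷ p) q = ∷-cong (⊞-congˡ q (⊠-false∷ p q))

⊠-identityˡ : ∀ p → one ⊠ p ≈ p
⊠-identityˡ p = ≈-trans (⊞-congˡ p (false∷-≈[] ≈-refl)) (⊞-identityʳ p)

⊠-identityʳ : ∀ p → p ⊠ one ≈ p
⊠-identityʳ [] = ≈-refl
⊠-identityʳ (false ∷ p) = ∷-cong (⊠-identityʳ p)
⊠-identityʳ (true ∷ p) = ∷-cong (⊠-identityʳ p)

⊠-constant : ∀ c q → q ⊠ (c ∷ []) ≈ scale c q
⊠-constant true q = ⊠-identityʳ q
⊠-constant false q = ≈-trans (⊠-false∷ q []) (false∷-≈[] (⊠-zeroʳ q))

∷-split : ∀ c p → c ∷ p ≈ (c ∷ []) ⊞ (false ∷ p)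
∷-split c p = mk≈ λ { zero → sym (xor-identityʳ c) ; (suc i) → refl }

⊠-comm : ∀ p q → p ⊠ q ≈ q ⊠ p
⊠-comm [] q = ≈-sym (⊠-zeroʳ q)
⊠-comm (c ∷ p) q = begin
  scale c q ⊞ (false ∷ p ⊠ q)          ≈⟨ ⊞-cong (≈-sym (⊠-constant c q)) (∷-cong (⊠-comm p q)) ⟩
  q ⊠ (c ∷ []) ⊞ (false ∷ q ⊠ p)       ≈⟨ ⊞-congˡ (q ⊠ (c ∷ [])) (⊠-false∷ q p) ⟨
  q ⊠ (c ∷ []) ⊞ q ⊠ (false ∷ p)       ≈⟨ ⊠-distribˡ q _ _ ⟨
  q ⊠ ((c ∷ []) ⊞ (false ∷ p))         ≈⟨ ⊠-congˡ q (∷-split c p) ⟨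
  q ⊠ (c ∷ p)                          ∎
  where open ≈-Reasoning

⊠-congʳ : ∀ {p p′} q → p ≈ p′ → p ⊠ q ≈ p′ ⊠ q
⊠-congʳ {p} {p′} q h = ≈-trans (⊠-comm p q) (≈-trans (⊠-congˡ q h) (⊠-comm q p′))

⊠-cong : ∀ {p p′ q q′} → p ≈ p′ → q ≈ q′ → p ⊠ q ≈ p′ ⊠ q′
⊠-cong {p} {p′} {q} h g = ≈-trans (⊠-congʳ q h) (⊠-congˡ p′ g)

scale-⊠ : ∀ c q r → scale c q ⊠ r ≡ scale c (q ⊠ r)
scale-⊠ false q r = refl
scale-⊠ true q r = refl

⊠-assoc : ∀ p q r → (p ⊠ q) ⊠ r ≈ p ⊠ (q ⊠ r)
⊠-assoc [] q r = ≈-refl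
⊠-assoc (c ∷ p) q r = begin
  (scale c q ⊞ (false ∷ p ⊠ q)) ⊠ r     ≈⟨ ⊠-distribʳ r (scale c q) _ ⟩
  scale c q ⊠ r ⊞ (false ∷ (p ⊠ q) ⊠ r) ≈⟨ ⊞-cong (≡⇒≈ (scale-⊠ c q r)) (∷-cong (⊠-assoc p q r)) ⟩
  (c ∷ p) ⊠ (q ⊠ r)                     ∎
  where open ≈-Reasoning

F₂[x] : CommutativeSemiring 0ℓ 0ℓ
F₂[x] = record
  { isCommutativeSemiring = record
    { isSemiring = record
      { isSemiringWithoutAnnihilatingZero = record
        { +-isCommutativeMonoid = ⊞-isCommutativeMonoid
        ; *-cong = ⊠-cong
        ; *-assoc = ⊠-assoc
        ; *-identity = ⊠-identityˡ , ⊠-identityʳ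
        ; distrib = ⊠-distribˡ , ⊠-distribʳ }
      ; zero = (λ p → ≈-refl) , ⊠-zeroʳ }
    ; *-comm = ⊠-comm } }

open import Algebra.Properties.CommutativeSemiring.Exp F₂[x]
  using (^-congˡ; ^-congʳ; ^-homo-*; ^-assocʳ; ^-distrib-*) renaming (_^_ to _^ᵖ_)
open import Algebra.Solver.Ring.NaturalCoefficients F₂[x] (λ _ _ → nothing)
  using (solve; _:=_; _:+_; _:*_; con)

⊠-leftComm : ∀ p q r → p ⊠ (q ⊠ r) ≈ q ⊠ (p ⊠ r)
⊠-leftComm = solve 3 (λ p q r → p :* (q :* r) := q :* (p :* r)) ≈-refl

⊕≈⊞ : ∀ p q → p ⊕ q ≈ p ⊞ q
⊕≈⊞ p q = trim-≈ (p ⊞ q)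

mulX≈ : ∀ p → mulX p ≈ false ∷ p
mulX≈ p with trim p | trim-≈ p
... | [] | h = ≈-sym (false∷-≈[] (≈-sym h))
... | _ ∷ _ | h = ∷-cong h

⊗≈⊠ : ∀ p q → p ⊗ q ≈ p ⊠ q
⊗≈⊠ [] q = ≈-refl
⊗≈⊠ (c ∷ p) q = ≈-trans (⊕≈⊞ (if c then trim q else []) (mulX (p ⊗ q)))
  (⊞-cong (scale-trim c) (≈-trans (mulX≈ (p ⊗ q)) (∷-cong (⊗≈⊠ p q))))
  where
  scale-trim : ∀ c → (if c then trim q else []) ≈ scale c q
  scale-trim false = ≈-refl
  scale-trim true = trim-≈ q

^P≈^ᵖ : ∀ p n → p ^P n ≈ p ^ᵖ n
^P≈^ᵖ p zero = ≈-refl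
^P≈^ᵖ p (suc n) = ≈-trans (⊗≈⊠ p (p ^P n)) (⊠-congˡ p (^P≈^ᵖ p n))

X X+1 : Poly
X = false ∷ true ∷ []
X+1 = true ∷ true ∷ []

N : Poly
N = false ∷ true ∷ true ∷ []

N≈X⊠X+1 : N ≈ X ⊠ X+1
N≈X⊠X+1 = mk≈ λ { zero → refl ; (suc zero) → refl ; (suc (suc zero)) → refl ; (suc (suc (suc i))) → refl }

evalZero : Poly → Bool
evalZero p = coeff p 0

evalZero-⊞ : ∀ p q → evalZero (p ⊞ q) ≡ evalZero p xor evalZero q
evalZero-⊞ p q = coeff-⊞ p q 0

evalZero-⊠ : ∀ p q → evalZero (p ⊠ q) ≡ evalZero p ∧ evalZero q
evalZero-⊠ [] q = refl
evalZero-⊠ (false ∷ p) q = refl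
evalZero-⊠ (true ∷ p) q = trans (coeff-⊞ q (false ∷ p ⊠ q) 0) (xor-identityʳ _)

evalOne-cong : ∀ {p q} → p ≈ q → evalOne p ≡ evalOne q
evalOne-cong {[]} {[]} h = refl
evalOne-cong {[]} {d ∷ q} h rewrite sym (coeff-≡ h zero) = evalOne-cong {[]} {q} ([]≈∷-tail h)
evalOne-cong {c ∷ p} {[]} h = cong₂ _xor_ (coeff-≡ h zero) (evalOne-cong {p} {[]} (∷≈[]-tail h))
evalOne-cong {c ∷ p} {d ∷ q} h = cong₂ _xor_ (coeff-≡ h zero) (evalOne-cong (∷-≈-tail h))

evalOne-⊞ : ∀ p q → evalOne (p ⊞ q) ≡ evalOne p xor evalOne q
evalOne-⊞ [] q = refl
evalOne-⊞ (c ∷ p) [] = sym (xor-identityʳ _)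
evalOne-⊞ (c ∷ p) (d ∷ q) =
  trans (cong ((c xor d) xor_) (evalOne-⊞ p q)) (xor-interchange c d (evalOne p) (evalOne q))

evalOne-⊠ : ∀ p q → evalOne (p ⊠ q) ≡ evalOne p ∧ evalOne q
evalOne-⊠ [] q = refl
evalOne-⊠ (c ∷ p) q = begin
  evalOne (scale c q ⊞ (false ∷ p ⊠ q))        ≡⟨ evalOne-⊞ (scale c q) (false ∷ p ⊠ q) ⟩
  evalOne (scale c q) xor evalOne (p ⊠ q)      ≡⟨ cong₂ _xor_ (evalOne-scale c) (evalOne-⊠ p q) ⟩
  (c ∧ evalOne q) xor (evalOne p ∧ evalOne q)  ≡⟨ ∧-distribʳ-xor (evalOne q) c (evalOne p) ⟨
  (c xor evalOne p) ∧ evalOne q                ∎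
  where
  open ≡-Reasoning
  evalOne-scale : ∀ c → evalOne (scale c q) ≡ c ∧ evalOne q
  evalOne-scale false = refl
  evalOne-scale true = refl

record RootOfN : Set where
  field
    eval : Poly → Bool
    eval-⊞ : ∀ p q → eval (p ⊞ q) ≡ eval p xor eval q
    eval-⊠ : ∀ p q → eval (p ⊠ q) ≡ eval p ∧ eval q
    eval-one : eval one ≡ true
    eval-N : eval N ≡ false
open RootOfN

x≔0 x≔1 : RootOfN
x≔0 = record { eval = evalZero ; eval-⊞ = evalZero-⊞ ; eval-⊠ = evalZero-⊠ ; eval-one = refl ; eval-N = refl }
x≔1 = record { eval = evalOne ; eval-⊞ = evalOne-⊞ ; eval-⊠ = evalOne-⊠ ; eval-one = refl ; eval-N = refl }

eval-^ : ∀ ρ p n → eval ρ p ≡ true → eval ρ (p ^ᵖ n) ≡ true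
eval-^ ρ p zero h = eval-one ρ
eval-^ ρ p (suc n) h = trans (eval-⊠ ρ p (p ^ᵖ n)) (cong₂ _∧_ h (eval-^ ρ p n h))

Rootless : Poly → Set
Rootless p = evalZero p ≡ true × evalOne p ≡ true

rootless-^ : ∀ p n → Rootless p → Rootless (p ^ᵖ n)
rootless-^ p n (p₀ , p₁) = eval-^ x≔0 p n p₀ , eval-^ x≔1 p n p₁

X+1⊠ : ∀ r → X+1 ⊠ r ≈ r ⊞ (false ∷ r)
X+1⊠ r = ⊞-congˡ r (∷-cong (⊠-identityˡ r))

shift : ℕ → Poly → Poly
shift zero r = r
shift (suc k) r = false ∷ shift k r

X^⊠ : ∀ k r → X ^ᵖ k ⊠ r ≈ shift k r
X^⊠ zero r = ⊠-identityˡ r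
X^⊠ (suc k) r = ≈-trans (⊠-assoc X (X ^ᵖ k) r) (∷-cong (≈-trans (⊠-identityˡ _) (X^⊠ k r)))

shift-≈[] : ∀ k r → shift k r ≈ [] → r ≈ []
shift-≈[] zero r h = h
shift-≈[] (suc k) r h = shift-≈[] k r (∷≈[]-tail h)

X-cancel : ∀ p q → X ⊠ p ≈ X ⊠ q → p ≈ q
X-cancel p q h = ∷-≈-tail (≈-trans (≈-sym (X^⊠ 1 p)) (≈-trans h (X^⊠ 1 q)))

X+1⊠-≈[] : ∀ d → X+1 ⊠ d ≈ [] → d ≈ []
X+1⊠-≈[] d h = mk≈ go
  where
  d⊞x·d≡0 : ∀ i → coeff d i xor coeff (false ∷ d) i ≡ false
  d⊞x·d≡0 i = trans (sym (coeff-⊞ d (false ∷ d) i)) (trans (sym (coeff-≡ (X+1⊠ d) i)) (coeff-≡ h i))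
  go : ∀ i → coeff d i ≡ false
  go zero = trans (sym (xor-identityʳ _)) (d⊞x·d≡0 zero)
  go (suc i) = trans (sym (xor-identityʳ _)) (trans (cong (coeff d (suc i) xor_) (sym (go i))) (d⊞x·d≡0 (suc i)))

X+1-cancel : ∀ p q → X+1 ⊠ p ≈ X+1 ⊠ q → p ≈ q
X+1-cancel p q h = ⊞-cancel p q (X+1⊠-≈[] (p ⊞ q) (begin
  X+1 ⊠ (p ⊞ q)         ≈⟨ ⊠-distribˡ X+1 p q ⟩
  X+1 ⊠ p ⊞ X+1 ⊠ q     ≈⟨ ⊞-cong h ≈-refl ⟩
  X+1 ⊠ q ⊞ X+1 ⊠ q     ≈⟨ ⊞-self (X+1 ⊠ q) ⟩
  []                    ∎))
  where open ≈-Reasoning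

X+1⊠prefixXor : ∀ acc p → acc xor evalOne p ≡ false → X+1 ⊠ prefixXor acc p ≈ (acc ∷ []) ⊞ p
X+1⊠prefixXor false [] h = mk≈ λ { zero → refl ; (suc zero) → refl ; (suc (suc i)) → refl }
X+1⊠prefixXor true [] ()
X+1⊠prefixXor acc (c ∷ []) h = mk≈ λ
  { zero → sym (trans (cong (acc xor_) (sym (xor-identityʳ c))) h) ; (suc zero) → refl ; (suc (suc i)) → refl }
X+1⊠prefixXor acc (c ∷ d ∷ p′) h = begin
  X+1 ⊠ (a ∷ R)                      ≈⟨ X+1⊠ (a ∷ R) ⟩
  (a ∷ R) ⊞ (false ∷ a ∷ R)          ≈⟨ mk≈ (λ { zero → xor-identityʳ a ; (suc i) → refl }) ⟩
  a ∷ (R ⊞ (a ∷ R))                  ≈⟨ ∷-cong (⊞-congˡ R (∷-split a R)) ⟩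
  a ∷ (R ⊞ ((a ∷ []) ⊞ (false ∷ R)))
    ≈⟨ ∷-cong (solve 3 (λ r a f → r :+ (a :+ f) := a :+ (r :+ f)) ≈-refl R (a ∷ []) (false ∷ R)) ⟩
  a ∷ ((a ∷ []) ⊞ (R ⊞ (false ∷ R))) ≈⟨ ∷-cong (⊞-congˡ (a ∷ []) (≈-trans (≈-sym (X+1⊠ R))
      (X+1⊠prefixXor (acc xor c) (d ∷ p′) (trans (xor-assoc acc c (evalOne (d ∷ p′))) h)))) ⟩
  a ∷ ((a ∷ []) ⊞ ((a ∷ []) ⊞ p))    ≈⟨ ∷-cong (⊞-self-cancelˡ (a ∷ []) p) ⟩
  a ∷ p                              ∎
  where
  open ≈-Reasoning
  a = acc xor c
  p = d ∷ p′
  R = prefixXor a p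

X+1⊠divX1 : ∀ p → evalOne p ≡ false → X+1 ⊠ divX1 p ≈ p
X+1⊠divX1 [] h = ⊠-zeroʳ X+1
X+1⊠divX1 p@(_ ∷ _) h = ≈-trans (⊠-congˡ X+1 (trim-≈ (prefixXor false p))) (X+1⊠prefixXor false p h)

Degree : Poly → ℕ → Set
Degree p i = coeff p i ≡ true × (∀ j → i < j → coeff p j ≡ false)

degree-≈ : ∀ {p q i} → p ≈ q → Degree p i → Degree q i
degree-≈ {i = i} h (top , above) = trans (sym (coeff-≡ h i)) top , λ j i<j → trans (sym (coeff-≡ h j)) (above j i<j)

≈[]⊎degree : ∀ p → p ≈ [] ⊎ ∃ (Degree p)
≈[]⊎degree [] = inj₁ ≈-refl
≈[]⊎degree (c ∷ p) with ≈[]⊎degree p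
... | inj₂ (i , top , above) = inj₂ (suc i , top , λ { zero () ; (suc j) (s≤s i<j) → above j i<j })
≈[]⊎degree (true ∷ p) | inj₁ h = inj₂ (zero , refl , λ { zero () ; (suc j) _ → coeff-≡ h j })
≈[]⊎degree (false ∷ p) | inj₁ h = inj₁ (false∷-≈[] h)

degree-X+1⊠ : ∀ {d i} → Degree d i → Degree (X+1 ⊠ d) (suc i)
degree-X+1⊠ {d} {i} (top , above) =
  coeff-at (suc i) (cong₂ _xor_ (above (suc i) ≤-refl) top) ,
  λ { zero () ; (suc j) (s≤s i<j) →
        coeff-at (suc j) (cong₂ _xor_ (above (suc j) (≤-trans (n≤1+n _) (s≤s i<j))) (above j i<j)) }
  where
  coeff-at : ∀ j {b} → coeff d j xor coeff (false ∷ d) j ≡ b → coeff (X+1 ⊠ d) j ≡ b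
  coeff-at j e = trans (coeff-≡ (X+1⊠ d) j) (trans (coeff-⊞ d (false ∷ d) j) e)

degree-X+1^⊠ : ∀ {Q i} k → Degree Q i → Degree (X+1 ^ᵖ k ⊠ Q) (k + i)
degree-X+1^⊠ {Q} zero deg = degree-≈ (≈-sym (⊠-identityˡ Q)) deg
degree-X+1^⊠ {Q} (suc k) deg =
  degree-≈ (≈-sym (⊠-assoc X+1 (X+1 ^ᵖ k) Q)) (degree-X+1⊠ {X+1 ^ᵖ k ⊠ Q} (degree-X+1^⊠ k deg))

coeff≡true⇒<length : ∀ p i → coeff p i ≡ true → i < length p
coeff≡true⇒<length (c ∷ p) zero h = s≤s z≤n
coeff≡true⇒<length (c ∷ p) (suc i) h = s≤s (coeff≡true⇒<length p i h)

stripX-trim-shift : ∀ k r → evalZero r ≡ true → stripX (trim (shift k r)) ≡ trim r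
stripX-trim-shift (suc k) r h rewrite trim-∷ false (shift k r) with trim (shift k r) | stripX-trim-shift k r h
... | [] | e = e
... | _ ∷ _ | e = e
stripX-trim-shift zero (true ∷ r) refl rewrite trim-∷ true r with trim r | trim-idem r
... | [] | _ = refl
... | c ∷ q | e rewrite trim-∷ true (c ∷ q) | e = refl

evalZero-X+1^⊠ : ∀ k Q → evalZero Q ≡ true → evalZero (X+1 ^ᵖ k ⊠ Q) ≡ true
evalZero-X+1^⊠ k Q Q₀ = trans (evalZero-⊠ (X+1 ^ᵖ k) Q) (cong₂ _∧_ (eval-^ x≔0 X+1 k refl) Q₀)

evalOne-[X+1]^⊠ : ∀ {p} k Q → p ≈ X+1 ^ᵖ suc k ⊠ Q → evalOne p ≡ false
evalOne-[X+1]^⊠ {p} k Q h =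
  trans (evalOne-cong (≈-trans h (⊠-assoc X+1 (X+1 ^ᵖ k) Q))) (evalOne-⊠ X+1 (X+1 ^ᵖ k ⊠ Q))

stripX1′-X+1^⊠ : ∀ {Q} → Rootless Q → ∀ n k p → trim p ≡ p → p ≈ X+1 ^ᵖ k ⊠ Q → k < n →
                 stripX1' n p ≡ trim Q
stripX1′-X+1^⊠ {Q} (Q₀ , Q₁) (suc n) k [] _ h _
  with trans (coeff-≡ h 0) (evalZero-X+1^⊠ k Q Q₀)
... | ()
stripX1′-X+1^⊠ {Q} (Q₀ , Q₁) (suc n) zero p@(_ ∷ _) p-trim h _
  rewrite evalOne-cong (≈-trans h (⊠-identityˡ Q)) | Q₁ = trans (sym p-trim) (≈⇒trim≡ (≈-trans h (⊠-identityˡ Q)))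
stripX1′-X+1^⊠ {Q} Q-rootless (suc n) (suc k) p@(_ ∷ _) _ h (s≤s k<n)
  rewrite evalOne-[X+1]^⊠ k Q h = stripX1′-X+1^⊠ Q-rootless n k (divX1 p) (trim-idem (prefixXor false p))
    (X+1-cancel (divX1 p) (X+1 ^ᵖ k ⊠ Q)
      (≈-trans (X+1⊠divX1 p (evalOne-[X+1]^⊠ k Q h)) (≈-trans h (⊠-assoc X+1 (X+1 ^ᵖ k) Q)))) k<n

oddPart-X^⊠X+1^⊠ : ∀ {P} i k Q → Rootless Q → P ≈ X ^ᵖ i ⊠ (X+1 ^ᵖ k ⊠ Q) → oddPart P ≡ trim Q
oddPart-X^⊠X+1^⊠ {P} i k Q Q-rootless@(Q₀ , _) h = begin
  stripX1 (stripX (trim P))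
    ≡⟨ cong (λ p → stripX1 (stripX p)) (≈⇒trim≡ (≈-trans h (X^⊠ i R))) ⟩
  stripX1 (stripX (trim (shift i R)))
    ≡⟨ cong stripX1 (stripX-trim-shift i R (evalZero-X+1^⊠ k Q Q₀)) ⟩
  stripX1 (trim R)
    ≡⟨ stripX1′-X+1^⊠ Q-rootless (length (trim R)) k (trim R) (trim-idem R) (trim-≈ R) k<length ⟩
  trim Q
    ∎
  where
  open ≡-Reasoning
  R = X+1 ^ᵖ k ⊠ Q
  -- stripX1 gets fuel length (trim R), which suffices as deg ((x+1)ᵏ Q) ≥ k.
  k<length : k < length (trim R)
  k<length with ≈[]⊎degree Q
  ... | inj₁ Q≈[] with trans (sym (coeff-≡ Q≈[] 0)) Q₀
  ...   | ()
  k<length | inj₂ (i , deg) = <-≤-trans (s≤s (m≤m+n k i))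
    (coeff≡true⇒<length (trim R) (k + i) (proj₁ (degree-≈ (≈-sym (trim-≈ R)) (degree-X+1^⊠ k deg))))

N-cancel : ∀ p q → N ⊠ p ≈ N ⊠ q → p ≈ q
N-cancel p q h = X+1-cancel p q (X-cancel (X+1 ⊠ p) (X+1 ⊠ q) (begin
  X ⊠ (X+1 ⊠ p) ≈⟨ ⊠-assoc X X+1 p ⟨
  X ⊠ X+1 ⊠ p   ≈⟨ ⊠-congʳ p N≈X⊠X+1 ⟨
  N ⊠ p         ≈⟨ h ⟩
  N ⊠ q         ≈⟨ ⊠-congʳ q N≈X⊠X+1 ⟩
  X ⊠ X+1 ⊠ q   ≈⟨ ⊠-assoc X X+1 q ⟩
  X ⊠ (X+1 ⊠ q) ∎))
  where open ≈-Reasoning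

N^⊠≈X^⊠X+1^⊠ : ∀ k R → N ^ᵖ k ⊠ R ≈ X ^ᵖ k ⊠ (X+1 ^ᵖ k ⊠ R)
N^⊠≈X^⊠X+1^⊠ k R = begin
  N ^ᵖ k ⊠ R                   ≈⟨ ⊠-congʳ R (^-congˡ k N≈X⊠X+1) ⟩
  (X ⊠ X+1) ^ᵖ k ⊠ R           ≈⟨ ⊠-congʳ R (^-distrib-* X X+1 k) ⟩
  X ^ᵖ k ⊠ X+1 ^ᵖ k ⊠ R        ≈⟨ ⊠-assoc (X ^ᵖ k) (X+1 ^ᵖ k) R ⟩
  X ^ᵖ k ⊠ (X+1 ^ᵖ k ⊠ R)      ∎
  where open ≈-Reasoning

oddPart-N^⊠ : ∀ {P} k Q → Rootless Q → P ≈ N ^ᵖ k ⊠ Q → oddPart P ≡ trim Q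
oddPart-N^⊠ k Q Q-rootless h = oddPart-X^⊠X+1^⊠ k k Q Q-rootless (≈-trans h (N^⊠≈X^⊠X+1^⊠ k Q))

N^⊠-≉[] : ∀ k R → evalZero R ≡ true → ¬ (N ^ᵖ k ⊠ R ≈ [])
N^⊠-≉[] k R R₀ h with trans (sym (coeff-≡ [X+1]^k⊠R≈[] 0)) (evalZero-X+1^⊠ k R R₀)
  where
  [X+1]^k⊠R≈[] : X+1 ^ᵖ k ⊠ R ≈ []
  [X+1]^k⊠R≈[] = shift-≈[] k _ (≈-trans (≈-sym (X^⊠ k _)) (≈-trans (≈-sym (N^⊠≈X^⊠X+1^⊠ k R)) h))
... | ()

^-double : ∀ p n → p ^ᵖ (2 * n) ≈ p ^ᵖ n ⊠ p ^ᵖ n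
^-double p n = ≈-trans (^-congʳ p (cong (n +_) (+-identityʳ n))) (^-homo-* p n n)

⊞-square : ∀ p q → (p ⊞ q) ⊠ (p ⊞ q) ≈ p ⊠ p ⊞ q ⊠ q
⊞-square p q = begin
  (p ⊞ q) ⊠ (p ⊞ q)
    ≈⟨ solve 2 (λ p q → (p :+ q) :* (p :+ q) := (p :* p :+ q :* q) :+ (p :* q :+ p :* q)) ≈-refl p q ⟩
  (p ⊠ p ⊞ q ⊠ q) ⊞ (p ⊠ q ⊞ p ⊠ q) ≈⟨ ⊞-congˡ (p ⊠ p ⊞ q ⊠ q) (⊞-self (p ⊠ q)) ⟩
  (p ⊠ p ⊞ q ⊠ q) ⊞ []              ≈⟨ ⊞-identityʳ _ ⟩
  p ⊠ p ⊞ q ⊠ q                     ∎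
  where open ≈-Reasoning

frobenius : ∀ e p q → (p ⊞ q) ^ᵖ 2 ^ e ≈ p ^ᵖ 2 ^ e ⊞ q ^ᵖ 2 ^ e
frobenius zero p q = solve 2 (λ p q → (p :+ q) :* con 1 := p :* con 1 :+ q :* con 1) ≈-refl p q
frobenius (suc e) p q = begin
  (p ⊞ q) ^ᵖ (2 * K)                       ≈⟨ ^-double (p ⊞ q) K ⟩
  (p ⊞ q) ^ᵖ K ⊠ (p ⊞ q) ^ᵖ K              ≈⟨ ⊠-cong (frobenius e p q) (frobenius e p q) ⟩
  (p ^ᵖ K ⊞ q ^ᵖ K) ⊠ (p ^ᵖ K ⊞ q ^ᵖ K)    ≈⟨ ⊞-square (p ^ᵖ K) (q ^ᵖ K) ⟩
  p ^ᵖ K ⊠ p ^ᵖ K ⊞ q ^ᵖ K ⊠ q ^ᵖ K        ≈⟨ ⊞-cong (^-double p K) (^-double q K) ⟨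
  p ^ᵖ (2 * K) ⊞ q ^ᵖ (2 * K)              ∎
  where
  open ≈-Reasoning
  K = 2 ^ e

one-^ : ∀ n → one ^ᵖ n ≈ one
one-^ zero = ≈-refl
one-^ (suc n) = ≈-trans (⊠-identityˡ (one ^ᵖ n)) (one-^ n)

one⊞-^2^ : ∀ e p → (one ⊞ p) ^ᵖ 2 ^ e ≈ one ⊞ p ^ᵖ 2 ^ e
one⊞-^2^ e p = ≈-trans (frobenius e one p) (⊞-cong (one-^ (2 ^ e)) (≈-refl {p ^ᵖ 2 ^ e}))

Geom : ℕ → Poly
Geom zero = []
Geom (suc n) = one ⊞ M ⊠ Geom n

N⊠Geom : ∀ n → N ⊠ Geom n ≈ one ⊞ M ^ᵖ n
N⊠Geom zero = ≈-trans (⊠-zeroʳ N) (≈-sym (⊞-self one))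
N⊠Geom (suc n) = begin
  N ⊠ (one ⊞ M ⊠ Geom n)
    ≈⟨ solve 2 (λ m g → (con 1 :+ m) :* (con 1 :+ m :* g) := (con 1 :+ m) :+ m :* ((con 1 :+ m) :* g)) ≈-refl M (Geom n) ⟩
  (one ⊞ M) ⊞ M ⊠ (N ⊠ Geom n)
    ≈⟨ ⊞-congˡ (one ⊞ M) (⊠-congˡ M (N⊠Geom n)) ⟩
  (one ⊞ M) ⊞ M ⊠ (one ⊞ M ^ᵖ n)
    ≈⟨ solve 2 (λ m p → (con 1 :+ m) :+ m :* (con 1 :+ p) := con 1 :+ ((m :+ m) :+ m :* p)) ≈-refl M (M ^ᵖ n) ⟩
  one ⊞ ((M ⊞ M) ⊞ M ⊠ M ^ᵖ n)
    ≈⟨ ⊞-congˡ one (⊞-cong (⊞-self M) (≈-refl {M ^ᵖ suc n})) ⟩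
  one ⊞ M ^ᵖ suc n
    ∎
  where open ≈-Reasoning

Geom-2^* : ∀ i m → Geom (2 ^ i * m) ≈ N ^ᵖ mersenne i ⊠ Geom m ^ᵖ 2 ^ i
Geom-2^* i m = N-cancel _ _ (begin
  N ⊠ Geom (2 ^ i * m)                    ≈⟨ N⊠Geom (2 ^ i * m) ⟩
  one ⊞ M ^ᵖ (2 ^ i * m)                  ≈⟨ ⊞-congˡ one M^[2^i*m]≈ ⟩
  one ⊞ (M ^ᵖ m) ^ᵖ 2 ^ i                 ≈⟨ one⊞-^2^ i (M ^ᵖ m) ⟨
  (one ⊞ M ^ᵖ m) ^ᵖ 2 ^ i                 ≈⟨ ^-congˡ (2 ^ i) (N⊠Geom m) ⟨
  (N ⊠ Geom m) ^ᵖ 2 ^ i                   ≈⟨ ^-distrib-* N (Geom m) (2 ^ i) ⟩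
  N ^ᵖ 2 ^ i ⊠ Geom m ^ᵖ 2 ^ i            ≈⟨ ⊠-congʳ (Geom m ^ᵖ 2 ^ i) (^-congʳ N (sym (suc-mersenne i))) ⟩
  N ⊠ N ^ᵖ mersenne i ⊠ Geom m ^ᵖ 2 ^ i   ≈⟨ ⊠-assoc N (N ^ᵖ mersenne i) (Geom m ^ᵖ 2 ^ i) ⟩
  N ⊠ (N ^ᵖ mersenne i ⊠ Geom m ^ᵖ 2 ^ i) ∎)
  where
  open ≈-Reasoning
  M^[2^i*m]≈ : M ^ᵖ (2 ^ i * m) ≈ (M ^ᵖ m) ^ᵖ 2 ^ i
  M^[2^i*m]≈ = ≈-trans (^-congʳ M (*-comm (2 ^ i) m)) (≈-sym (^-assocʳ M m (2 ^ i)))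

Geom-suc-at-root : ∀ ρ n → eval ρ (Geom (suc n)) ≡ not (eval ρ (Geom n))
Geom-suc-at-root ρ n = trans (eval-⊞ ρ one (M ⊠ Geom n))
  (cong₂ _xor_ (eval-one ρ) (trans (eval-⊠ ρ M (Geom n)) (cong (_∧ eval ρ (Geom n)) M↦1)))
  where
  M↦1 : eval ρ M ≡ true
  M↦1 = trans (eval-⊞ ρ one N) (cong₂ _xor_ (eval-one ρ) (eval-N ρ))

Geom-at-root : ∀ ρ k → eval ρ (Geom (suc (2 * k))) ≡ true
Geom-at-root ρ zero = trans (Geom-suc-at-root ρ 0) (cong not (trans (eval-⊞ ρ [] []) (xor-same (eval ρ []))))
Geom-at-root ρ (suc k) = begin
  eval ρ (Geom (suc (2 * suc k)))           ≡⟨ cong (λ n → eval ρ (Geom (suc n))) (*-suc 2 k) ⟩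
  eval ρ (Geom (suc (suc (suc (2 * k)))))   ≡⟨ Geom-suc-at-root ρ (suc (suc (2 * k))) ⟩
  not (eval ρ (Geom (suc (suc (2 * k)))))   ≡⟨ cong not (Geom-suc-at-root ρ (suc (2 * k))) ⟩
  not (not (eval ρ (Geom (suc (2 * k)))))   ≡⟨ not-involutive (eval ρ (Geom (suc (2 * k)))) ⟩
  eval ρ (Geom (suc (2 * k)))               ≡⟨ Geom-at-root ρ k ⟩
  true                                      ∎
  where open ≡-Reasoning

Geom-rootless : ∀ {m} → Odd m → Rootless (Geom m)
Geom-rootless (k , refl) = Geom-at-root x≔0 k , Geom-at-root x≔1 k

Geom-suc-^2^ : ∀ e n → Geom (suc n) ^ᵖ 2 ^ e ≈ one ⊞ M ^ᵖ 2 ^ e ⊠ Geom n ^ᵖ 2 ^ e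
Geom-suc-^2^ e n = ≈-trans (one⊞-^2^ e (M ⊠ Geom n)) (⊞-congˡ one (^-distrib-* M (Geom n) (2 ^ e)))

N^⊠-^ : ∀ a p n → (N ^ᵖ a ⊠ p) ^ᵖ n ≈ N ^ᵖ (a * n) ⊠ p ^ᵖ n
N^⊠-^ a p n = ≈-trans (^-distrib-* (N ^ᵖ a) p n) (⊠-congʳ (p ^ᵖ n) (^-assocʳ N a n))

Geom-2^*-^ : ∀ i m n → Geom (2 ^ i * m) ^ᵖ n ≈ N ^ᵖ (mersenne i * n) ⊠ Geom m ^ᵖ (2 ^ i * n)
Geom-2^*-^ i m n = ≈-trans (^-congˡ n (Geom-2^* i m)) (≈-trans (N^⊠-^ (mersenne i) (Geom m ^ᵖ 2 ^ i) n)
  (⊠-congˡ (N ^ᵖ (mersenne i * n)) (^-assocʳ (Geom m) (2 ^ i) n)))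

oddPart-cong : ∀ {p q} → p ≈ q → oddPart p ≡ oddPart q
oddPart-cong h = cong (λ p → stripX1 (stripX p)) (≈⇒trim≡ h)

collatz : Poly → Poly
collatz Q = oddPart (oneP ⊕ (M ⊗ Q))

collatz-≈ : ∀ {Q P} → Q ≈ P → collatz Q ≡ oddPart (one ⊞ M ⊠ P)
collatz-≈ {Q} h =
  oddPart-cong (≈-trans (⊕≈⊞ oneP (M ⊗ Q)) (⊞-congˡ one (≈-trans (⊗≈⊠ M Q) (⊠-congˡ M h))))

FirstOneAt : Poly → ℕ → Set
FirstOneAt Q d = iterate collatz Q d ≡ oneP × (∀ j → j < d → iterate collatz Q j ≢ oneP)

firstOneAt-one : FirstOneAt oneP 0
firstOneAt-one = refl , λ j ()

firstOneAt-≡ : ∀ {Q Q′ d d′} → Q ≡ Q′ → d ≡ d′ → FirstOneAt Q d → FirstOneAt Q′ d′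
firstOneAt-≡ refl refl first = first

firstOneAt-collatz : ∀ {Q d} → Q ≢ oneP → FirstOneAt (collatz Q) d → FirstOneAt Q (suc d)
firstOneAt-collatz Q≢1 (reached , before) = reached , λ { zero _ → Q≢1 ; (suc j) (s≤s j<d) → before j j<d }

oddSeq≡iterate : ∀ A k → oddSeq A k ≡ iterate collatz (oddPart A) k
oddSeq≡iterate A k = trans (oddSeq≡fold k) (iterate-is-fold (oddPart A) collatz k)
  where
  oddSeq≡fold : ∀ k → oddSeq A k ≡ fold (oddPart A) collatz k
  oddSeq≡fold zero = refl
  oddSeq≡fold (suc k) = cong collatz (oddSeq≡fold k)

firstOneAt⇒lengthIs : ∀ A d → FirstOneAt (oddPart A) d → LengthIs A (suc d)
firstOneAt⇒lengthIs A d (reached , before) =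
  s≤s z≤n , trans (oddSeq≡iterate A d) reached ,
  λ j j<d eq → before j j<d (trans (sym (oddSeq≡iterate A j)) eq)

G : ℕ → ℕ → Poly → Poly
G s t W = one ⊞ M ^ᵖ s ⊠ (N ^ᵖ t ⊠ W)

one⊞M⊠G : ∀ s t W → one ⊞ M ⊠ G s (suc t) W ≈ N ⊠ G (suc s) t W
one⊞M⊠G s t W = solve 4 (λ m p q w → con 1 :+ m :* (con 1 :+ p :* (((con 1 :+ m) :* q) :* w))
                                   := (con 1 :+ m) :* (con 1 :+ (m :* p) :* (q :* w)))
                        ≈-refl M (M ^ᵖ s) (N ^ᵖ t) W

G-at-root : ∀ ρ s t W → eval ρ (G s (suc t) W) ≡ true
G-at-root ρ s t W
  rewrite eval-⊞ ρ one (M ^ᵖ s ⊠ (N ^ᵖ suc t ⊠ W)) | eval-⊠ ρ (M ^ᵖ s) (N ^ᵖ suc t ⊠ W)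
        | eval-⊠ ρ (N ^ᵖ suc t) W | eval-⊠ ρ N (N ^ᵖ t) | eval-N ρ
        | ∧-zeroʳ (eval ρ (M ^ᵖ s)) | eval-one ρ = refl

G-rootless : ∀ s t W → Rootless (G s (suc t) W)
G-rootless s t W = G-at-root x≔0 s t W , G-at-root x≔1 s t W

collatz-G : ∀ s t W → collatz (trim (G s (suc t) W)) ≡ oddPart (N ⊠ G (suc s) t W)
collatz-G s t W = trans (collatz-≈ (trim-≈ (G s (suc t) W))) (oddPart-cong (one⊞M⊠G s t W))

collatz-G-suc : ∀ s t W → collatz (trim (G s (suc (suc t)) W)) ≡ trim (G (suc s) (suc t) W)
collatz-G-suc s t W = trans (collatz-G s (suc t) W)
  (oddPart-N^⊠ 1 (G (suc s) (suc t) W) (G-rootless (suc s) t W)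
    (⊠-congʳ (G (suc s) (suc t) W) (≈-sym (⊠-identityʳ N))))

trim-G-≢-one : ∀ s t W → evalZero W ≡ true → trim (G s (suc t) W) ≢ oneP
trim-G-≢-one s t W W₀ G≡1 = N^⊠-≉[] (suc t) (M ^ᵖ s ⊠ W) MW₀ (begin
  N ^ᵖ suc t ⊠ (M ^ᵖ s ⊠ W)       ≈⟨ ⊠-leftComm (N ^ᵖ suc t) (M ^ᵖ s) W ⟩
  M ^ᵖ s ⊠ (N ^ᵖ suc t ⊠ W)       ≈⟨ ⊞-self-cancelˡ one (M ^ᵖ s ⊠ (N ^ᵖ suc t ⊠ W)) ⟨
  one ⊞ G s (suc t) W             ≈⟨ ⊞-congˡ one (≈-trans (≈-sym (trim-≈ (G s (suc t) W))) (≡⇒≈ G≡1)) ⟩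
  one ⊞ one                       ≈⟨ ⊞-self one ⟩
  []                              ∎)
  where
  open ≈-Reasoning
  MW₀ : evalZero (M ^ᵖ s ⊠ W) ≡ true
  MW₀ = trans (evalZero-⊠ (M ^ᵖ s) W) (cong₂ _∧_ (eval-^ x≔0 M s refl) W₀)

firstOneAt-G : ∀ t s W d → 1 ≤ t → evalZero W ≡ true →
  FirstOneAt (oddPart (N ⊠ G (t + s) 0 W)) d → FirstOneAt (trim (G s t W)) (t + d)
firstOneAt-G (suc zero) s W d _ W₀ first =
  firstOneAt-collatz (trim-G-≢-one s 0 W W₀) (firstOneAt-≡ (sym (collatz-G s 0 W)) refl first)
firstOneAt-G (suc (suc t)) s W d _ W₀ first =
  firstOneAt-collatz (trim-G-≢-one s (suc t) W W₀) (firstOneAt-≡ (sym (collatz-G-suc s t W)) refl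
    (firstOneAt-G (suc t) (suc s) W d (s≤s z≤n) W₀
      (firstOneAt-≡ (cong (λ u → oddPart (N ⊠ G (suc u) 0 W)) (sym (+-suc t s))) refl first)))

Geom-suc-2^*-^2^ : ∀ j e m →
  Geom (suc (2 ^ j * m)) ^ᵖ 2 ^ e ≈ G (2 ^ e) (mersenne j * 2 ^ e) (Geom m ^ᵖ (2 ^ j * 2 ^ e))
Geom-suc-2^*-^2^ j e m =
  ≈-trans (Geom-suc-^2^ e (2 ^ j * m)) (⊞-congˡ one (⊠-congˡ (M ^ᵖ 2 ^ e) (Geom-2^*-^ j m (2 ^ e))))

N⊠G-Geom-^2^ : ∀ i e m m′ → suc m ≡ 2 ^ i * m′ →
  N ⊠ G (2 ^ e) 0 (Geom m ^ᵖ 2 ^ e) ≈ N ^ᵖ suc (mersenne i * 2 ^ e) ⊠ Geom m′ ^ᵖ (2 ^ i * 2 ^ e)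
N⊠G-Geom-^2^ i e m m′ suc-m≡ = begin
  N ⊠ (one ⊞ M ^ᵖ K ⊠ (one ⊠ Geom m ^ᵖ K))
    ≈⟨ ⊠-congˡ N (⊞-congˡ one (⊠-congˡ (M ^ᵖ K) (⊠-identityˡ (Geom m ^ᵖ K)))) ⟩
  N ⊠ (one ⊞ M ^ᵖ K ⊠ Geom m ^ᵖ K)
    ≈⟨ ⊠-congˡ N (Geom-suc-^2^ e m) ⟨
  N ⊠ Geom (suc m) ^ᵖ K
    ≈⟨ ⊠-congˡ N (≡⇒≈ (cong (λ n → Geom n ^ᵖ K) suc-m≡)) ⟩
  N ⊠ Geom (2 ^ i * m′) ^ᵖ K
    ≈⟨ ⊠-congˡ N (Geom-2^*-^ i m′ K) ⟩
  N ⊠ (N ^ᵖ (mersenne i * K) ⊠ Geom m′ ^ᵖ (2 ^ i * K))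
    ≈⟨ ⊠-assoc N (N ^ᵖ (mersenne i * K)) (Geom m′ ^ᵖ (2 ^ i * K)) ⟨
  N ^ᵖ suc (mersenne i * K) ⊠ Geom m′ ^ᵖ (2 ^ i * K)
    ∎
  where
  open ≈-Reasoning
  K = 2 ^ e

firstOneAt-Geom-step : ∀ j i e m m′ d → 1 ≤ j → Odd m → Odd m′ → suc m ≡ 2 ^ i * m′ →
  FirstOneAt (trim (Geom m′ ^ᵖ 2 ^ (i + (j + e)))) d →
  FirstOneAt (trim (Geom (suc (2 ^ j * m)) ^ᵖ 2 ^ e)) (mersenne j * 2 ^ e + d)
firstOneAt-Geom-step j@(suc _) i e m m′ d _ m-odd m′-odd suc-m≡ first =
  firstOneAt-≡ (sym (≈⇒trim≡ (Geom-suc-2^*-^2^ j e m))) refl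
    (firstOneAt-G t K W d 1≤t (proj₁ (rootless-^ (Geom m) (2 ^ j * K) (Geom-rootless m-odd)))
      (firstOneAt-≡ (sym reaches) refl first))
  where
  K = 2 ^ e
  t = mersenne j * K
  W = Geom m ^ᵖ (2 ^ j * K)
  1≤t : 1 ≤ t
  1≤t = *-mono-≤ {1} {mersenne j} {1} {K} (s≤s z≤n) (m^n>0 2 e)
  2^j*K≡ : 2 ^ j * K ≡ 2 ^ (j + e)
  2^j*K≡ = sym (^-distribˡ-+-* 2 j e)
  t+K≡ : t + K ≡ 2 ^ (j + e)
  t+K≡ = trans (+-comm t K) (trans (cong (_* K) (suc-mersenne j)) 2^j*K≡)
  reaches : oddPart (N ⊠ G (t + K) 0 W) ≡ trim (Geom m′ ^ᵖ 2 ^ (i + (j + e)))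
  reaches = begin
    oddPart (N ⊠ G (t + K) 0 W)
      ≡⟨ cong₂ (λ s n → oddPart (N ⊠ G s 0 (Geom m ^ᵖ n))) t+K≡ 2^j*K≡ ⟩
    oddPart (N ⊠ G (2 ^ (j + e)) 0 (Geom m ^ᵖ 2 ^ (j + e)))
      ≡⟨ oddPart-N^⊠ (suc (mersenne i * 2 ^ (j + e))) (Geom m′ ^ᵖ (2 ^ i * 2 ^ (j + e)))
           (rootless-^ (Geom m′) (2 ^ i * 2 ^ (j + e)) (Geom-rootless m′-odd)) (N⊠G-Geom-^2^ i (j + e) m m′ suc-m≡) ⟩
    trim (Geom m′ ^ᵖ (2 ^ i * 2 ^ (j + e)))
      ≡⟨ cong (λ n → trim (Geom m′ ^ᵖ n)) (sym (^-distribˡ-+-* 2 i (j + e))) ⟩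
    trim (Geom m′ ^ᵖ 2 ^ (i + (j + e)))
      ∎
    where open ≡-Reasoning

GeomOrbitLength : ℕ → Set
GeomOrbitLength m = ∀ e f → 2 ^ e * m ≤ 2 ^ f → 2 ^ f < 2 * (2 ^ e * m) →
  FirstOneAt (trim (Geom m ^ᵖ 2 ^ e)) (2 ^ f ∸ 2 ^ e * m)

Geom-1-orbitLength : GeomOrbitLength 1
Geom-1-orbitLength e f _ 2^f<2*2^e*1 = firstOneAt-≡ (sym trim-Geom-1-^≡1) (sym no-steps) firstOneAt-one
  where
  trim-Geom-1-^≡1 : trim (Geom 1 ^ᵖ 2 ^ e) ≡ oneP
  trim-Geom-1-^≡1 =
    ≈⇒trim≡ (≈-trans (^-congˡ (2 ^ e) (≈-trans (⊞-congˡ one (⊠-zeroʳ M)) (⊞-identityʳ one))) (one-^ (2 ^ e)))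
  f<1+e : f < suc e
  f<1+e = 2^-cancel-< {f} {suc e} (subst (2 ^ f <_) (cong (2 *_) (*-identityʳ (2 ^ e))) 2^f<2*2^e*1)
  no-steps : 2 ^ f ∸ 2 ^ e * 1 ≡ 0
  no-steps = m≤n⇒m∸n≡0 (subst (2 ^ f ≤_) (sym (*-identityʳ (2 ^ e))) (^-monoʳ-≤ 2 (s≤s⁻¹ f<1+e)))

Geom-orbitLength-step : ∀ j i m m′ → 1 ≤ j → Odd m → Odd m′ → suc m ≡ 2 ^ i * m′ →
  GeomOrbitLength m′ → GeomOrbitLength (suc (2 ^ j * m))
Geom-orbitLength-step j i m@(suc _) m′ 1≤j m-odd m′-odd suc-m≡ m′-orbit e f A≤2^f 2^f<2A =
  firstOneAt-≡ refl (sym length≡)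
    (firstOneAt-Geom-step j i e m m′ (2 ^ f ∸ B) 1≤j m-odd m′-odd suc-m≡
      (m′-orbit (i + (j + e)) f B≤2^f (<-≤-trans 2^f<2A (*-monoʳ-≤ 2 A≤B))))
  where
  A = 2 ^ e * suc (2 ^ j * m)
  B = 2 ^ (i + (j + e)) * m′
  t = mersenne j * 2 ^ e
  B≡2^[j+e]*suc-m : B ≡ 2 ^ (j + e) * suc m
  B≡2^[j+e]*suc-m = trans (2^[i+n]*m≡2^n*[2^i*m] i (j + e) m′) (cong (2 ^ (j + e) *_) (sym suc-m≡))
  B≡A+t : B ≡ A + t
  B≡A+t = trans B≡2^[j+e]*suc-m (2^[j+e]*suc-m j e m)
  2^[j+e]*m<A : 2 ^ (j + e) * m < A
  2^[j+e]*m<A =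
    subst (_< A) (sym (2^[i+n]*m≡2^n*[2^i*m] j e m)) (*-monoʳ-< (2 ^ e) {{m^n≢0 2 e}} (n<1+n (2 ^ j * m)))
  B≤2^f : B ≤ 2 ^ f
  B≤2^f = subst (_≤ 2 ^ f) (sym B≡2^[j+e]*suc-m) (2^*-suc-≤ (j + e) f m (<-≤-trans 2^[j+e]*m<A A≤2^f))
  A≤B : A ≤ B
  A≤B = subst (A ≤_) (sym B≡A+t) (m≤m+n A t)
  length≡ : 2 ^ f ∸ A ≡ t + (2 ^ f ∸ B)
  length≡ = trans (∸-split (2 ^ f) A t (subst (_≤ 2 ^ f) B≡A+t B≤2^f))
                  (cong (λ n → t + (2 ^ f ∸ n)) (sym B≡A+t))

Geom-orbitLength : ∀ m → Odd m → GeomOrbitLength m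
Geom-orbitLength = <-rec _ go
  where
  go : ∀ m → (∀ {m′} → m′ < m → Odd m′ → GeomOrbitLength m′) → Odd m → GeomOrbitLength m
  go _ _ (zero , refl) = Geom-1-orbitLength
  go _ rec (suc k , refl) with 2*suc≡2^suc*odd k
  ... | j , m , m-odd@(c , refl) , 2[1+k]≡ with 2*suc≡2^suc*odd c
  ...   | i , m′ , m′-odd , 2[1+c]≡ =
    subst GeomOrbitLength (cong suc (sym 2[1+k]≡))
      (Geom-orbitLength-step (suc j) (suc i) m m′ (s≤s z≤n) m-odd m′-odd suc-m≡
        (rec (subst (m′ <_) (cong suc (sym 2[1+k]≡)) (odd-part-of-suc-< (suc i) (suc j) m m′ (s≤s z≤n) suc-m≡)) m′-odd))
    where
    suc-m≡ : suc m ≡ 2 ^ suc i * m′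
    suc-m≡ = trans (sym (*-suc 2 c)) 2[1+c]≡

Apoly≈G : ∀ a b → Apoly a b ≈ G a b one
Apoly≈G a b = ≈-trans (⊕≈⊞ oneP ((M ^P a) ⊗ ((M ⊕ oneP) ^P b))) (⊞-congˡ one (begin
  (M ^P a) ⊗ (N ^P b)    ≈⟨ ⊗≈⊠ (M ^P a) (N ^P b) ⟩
  (M ^P a) ⊠ (N ^P b)    ≈⟨ ⊠-cong (^P≈^ᵖ M a) (^P≈^ᵖ N b) ⟩
  M ^ᵖ a ⊠ N ^ᵖ b        ≈⟨ ⊠-congˡ (M ^ᵖ a) (⊠-identityʳ (N ^ᵖ b)) ⟨
  M ^ᵖ a ⊠ (N ^ᵖ b ⊠ one) ∎))
  where open ≈-Reasoning

N⊠G-2^*-0-one : ∀ r u → N ⊠ G (2 ^ r * u) 0 one ≈ N ^ᵖ (2 + mersenne r) ⊠ Geom u ^ᵖ 2 ^ r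
N⊠G-2^*-0-one r u = begin
  N ⊠ (one ⊞ M ^ᵖ n ⊠ (one ⊠ one))
    ≈⟨ ⊠-congˡ N (⊞-congˡ one (≈-trans (⊠-congˡ (M ^ᵖ n) (⊠-identityʳ one)) (⊠-identityʳ (M ^ᵖ n)))) ⟩
  N ⊠ (one ⊞ M ^ᵖ n)
    ≈⟨ ⊠-congˡ N (N⊠Geom n) ⟨
  N ⊠ (N ⊠ Geom n)
    ≈⟨ ⊠-congˡ N (⊠-congˡ N (Geom-2^* r u)) ⟩
  N ⊠ (N ⊠ (N ^ᵖ mersenne r ⊠ Geom u ^ᵖ 2 ^ r))
    ≈⟨ solve 3 (λ n p q → n :* (n :* (p :* q)) := (n :* (n :* p)) :* q) ≈-refl N (N ^ᵖ mersenne r) (Geom u ^ᵖ 2 ^ r) ⟩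
  N ^ᵖ (2 + mersenne r) ⊠ Geom u ^ᵖ 2 ^ r
    ∎
  where
  open ≈-Reasoning
  n = 2 ^ r * u

Apoly-length : ∀ a b f → 1 ≤ b → a + b ≤ 2 ^ f → 2 ^ f < 2 * (a + b) → LengthIs (Apoly a b) (suc (2 ^ f ∸ a))
Apoly-length a b@(suc b′) f _ a+b≤2^f 2^f<2[a+b] with 2^*odd (b′ + a)
... | r , u , u-odd , b+a≡ =
  firstOneAt⇒lengthIs (Apoly a b) (2 ^ f ∸ a) (firstOneAt-≡ (sym oddPart-Apoly≡) length≡
    (firstOneAt-G b a one (2 ^ f ∸ (b + a)) (s≤s z≤n) refl (firstOneAt-≡ (sym reaches) refl orbit)))
  where
  a+b≡ : a + b ≡ 2 ^ r * u
  a+b≡ = trans (+-comm a b) b+a≡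
  orbit : FirstOneAt (trim (Geom u ^ᵖ 2 ^ r)) (2 ^ f ∸ (b + a))
  orbit = firstOneAt-≡ refl (cong (2 ^ f ∸_) (sym b+a≡))
    (Geom-orbitLength u u-odd r f (subst (_≤ 2 ^ f) a+b≡ a+b≤2^f) (subst (λ n → 2 ^ f < 2 * n) a+b≡ 2^f<2[a+b]))
  reaches : oddPart (N ⊠ G (b + a) 0 one) ≡ trim (Geom u ^ᵖ 2 ^ r)
  reaches = oddPart-N^⊠ (2 + mersenne r) (Geom u ^ᵖ 2 ^ r) (rootless-^ (Geom u) (2 ^ r) (Geom-rootless u-odd))
    (≈-trans (≡⇒≈ (cong (λ n → N ⊠ G n 0 one) b+a≡)) (N⊠G-2^*-0-one r u))
  oddPart-Apoly≡ : oddPart (Apoly a b) ≡ trim (G a b one)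
  oddPart-Apoly≡ =
    oddPart-N^⊠ 0 (G a b one) (G-rootless a b′ one) (≈-trans (Apoly≈G a b) (≈-sym (⊠-identityˡ (G a b one))))
  length≡ : b + (2 ^ f ∸ (b + a)) ≡ 2 ^ f ∸ a
  length≡ = sym (trans (∸-split (2 ^ f) a b a+b≤2^f) (cong (λ n → b + (2 ^ f ∸ n)) (+-comm a b)))

Apoly-length-2^r : ∀ a b r → 1 ≤ b → a + b ≡ 2 ^ r → LengthIs (Apoly a b) (b + 1)
Apoly-length-2^r a b r 1≤b a+b≡ = subst (LengthIs (Apoly a b)) length≡
  (Apoly-length a b r 1≤b (≤-reflexive a+b≡) (subst (λ n → 2 ^ r < 2 * n) (sym a+b≡) 2^r<2*2^r))
  where
  2^r<2*2^r : 2 ^ r < 2 * 2 ^ r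
  2^r<2*2^r = m<m+n (2 ^ r) (subst (0 <_) (sym (+-identityʳ (2 ^ r))) (m^n>0 2 r))
  length≡ : suc (2 ^ r ∸ a) ≡ b + 1
  length≡ = trans (cong (λ n → suc (n ∸ a)) (sym a+b≡)) (trans (cong suc (m+n∸m≡n a b)) (+-comm 1 b))

Apoly-length-2^r*u : ∀ a b r u w → 1 ≤ b → 3 ≤ u → a + b ≡ 2 ^ r * u → u ∸ 1 < 2 ^ w →
  (∀ w′ → 1 ≤ w′ → u ∸ 1 < 2 ^ w′ → w ≤ w′) → 1 ≤ w → LengthIs (Apoly a b) (b + 2 ^ r * (2 ^ w ∸ u) + 1)
Apoly-length-2^r*u a b r u@(suc u′) w 1≤b (s≤s 2≤u′) a+b≡ u≤2^w least 1≤w =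
  subst (LengthIs (Apoly a b)) length≡ (Apoly-length a b (r + w) 1≤b a+b≤2^[r+w] 2^[r+w]<2[a+b])
  where
  2^[r+w]≡ : 2 ^ (r + w) ≡ 2 ^ r * 2 ^ w
  2^[r+w]≡ = ^-distribˡ-+-* 2 r w
  a+b≤2^[r+w] : a + b ≤ 2 ^ (r + w)
  a+b≤2^[r+w] = subst₂ _≤_ (sym a+b≡) (sym 2^[r+w]≡) (*-monoʳ-≤ (2 ^ r) u≤2^w)
  2^[r+w]<2[a+b] : 2 ^ (r + w) < 2 * (a + b)
  2^[r+w]<2[a+b] = subst₂ _<_ (sym 2^[r+w]≡) (trans (x*[2*y]≡2*[x*y] (2 ^ r) u) (cong (2 *_) (sym a+b≡)))
    (*-monoʳ-< (2 ^ r) {{m^n≢0 2 r}} (≤-<-trans (least-2^-exceeding-≤-2* u′ w (≤-trans (s≤s z≤n) 2≤u′) 1≤w least)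
                                            (*-monoʳ-< 2 (n<1+n u′))))
    where
    x*[2*y]≡2*[x*y] : ∀ x y → x * (2 * y) ≡ 2 * (x * y)
    x*[2*y]≡2*[x*y] = solve-∀
  length≡ : suc (2 ^ (r + w) ∸ a) ≡ b + 2 ^ r * (2 ^ w ∸ u) + 1
  length≡ = trans (+-comm 1 _) (cong (_+ 1) (begin
    2 ^ (r + w) ∸ a                   ≡⟨ ∸-split (2 ^ (r + w)) a b a+b≤2^[r+w] ⟩
    b + (2 ^ (r + w) ∸ (a + b))       ≡⟨ cong₂ (λ x y → b + (x ∸ y)) 2^[r+w]≡ a+b≡ ⟩
    b + (2 ^ r * 2 ^ w ∸ 2 ^ r * u)   ≡⟨ cong (b +_) (*-distribˡ-∸ (2 ^ r) (2 ^ w) u) ⟨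
    b + 2 ^ r * (2 ^ w ∸ u)           ∎))
    where open ≡-Reasoning

Apoly-length-2^t+1 : ∀ a b t → 1 ≤ b → a + b ≡ 2 ^ t + 1 → LengthIs (Apoly a b) (a + 2 * b ∸ 1)
Apoly-length-2^t+1 a b t 1≤b a+b≡ =
  subst (LengthIs (Apoly a b)) (cong (_∸ 1) (sym a+2b≡)) (Apoly-length a b (suc t) 1≤b a+b≤2T 2T<2[a+b])
  where
  T = 2 ^ t
  1≤T : 1 ≤ T
  1≤T = m^n>0 2 t
  a+b≤2T : a + b ≤ 2 * T
  a+b≤2T = subst₂ _≤_ (trans (+-comm 1 T) (sym a+b≡)) (cong (T +_) (sym (+-identityʳ T))) (+-monoˡ-≤ T 1≤T)
  2T<2[a+b] : 2 * T < 2 * (a + b)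
  2T<2[a+b] = *-monoʳ-< 2 (subst (T <_) (trans (+-comm 1 T) (sym a+b≡)) (n<1+n T))
  a+2b≡ : a + 2 * b ≡ 2 + (2 * T ∸ a)
  a+2b≡ = +-cancelʳ-≡ a (a + 2 * b) (2 + (2 * T ∸ a)) (begin
    a + 2 * b + a          ≡⟨ x+2y+x≡2[x+y] a b ⟩
    2 * (a + b)            ≡⟨ cong (2 *_) a+b≡ ⟩
    2 * (T + 1)            ≡⟨ 2[x+1]≡2+2x T ⟩
    2 + 2 * T              ≡⟨ cong (2 +_) (sym (m∸n+n≡m (≤-trans (m≤m+n a b) a+b≤2T))) ⟩
    2 + (2 * T ∸ a + a)    ≡⟨ +-assoc 2 (2 * T ∸ a) a ⟨
    2 + (2 * T ∸ a) + a    ∎)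
    where
    open ≡-Reasoning
    x+2y+x≡2[x+y] : ∀ x y → x + 2 * y + x ≡ 2 * (x + y)
    x+2y+x≡2[x+y] = solve-∀
    2[x+1]≡2+2x : ∀ x → 2 * (x + 1) ≡ 2 + 2 * x
    2[x+1]≡2+2x = solve-∀

Apoly-length-2v+1 : ∀ a b v r → 2 ≤ a → 1 ≤ b → a + b ≡ 2 * v + 1 → 2 * v < 2 ^ r →
  (∀ r′ → 1 ≤ r′ → 2 * v < 2 ^ r′ → r ≤ r′) → 1 ≤ r → LengthIs (Apoly a b) (b + 2 ^ r ∸ 2 * v)
Apoly-length-2v+1 a b zero r (s≤s (s≤s _)) (s≤s _) a+b≡ _ _ _ = contradiction (trans (sym (+-suc a _)) a+b≡) λ ()
Apoly-length-2v+1 a b v@(suc _) r _ 1≤b a+b≡ 2v<2^r least 1≤r =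
  subst (LengthIs (Apoly a b)) length≡ (Apoly-length a b r 1≤b a+b≤2^r 2^r<2[a+b])
  where
  a+b≡suc-2v : a + b ≡ suc (2 * v)
  a+b≡suc-2v = trans a+b≡ (+-comm (2 * v) 1)
  a+b≤2^r : a + b ≤ 2 ^ r
  a+b≤2^r = subst (_≤ 2 ^ r) (sym a+b≡suc-2v) 2v<2^r
  2^r<2[a+b] : 2 ^ r < 2 * (a + b)
  2^r<2[a+b] = subst (λ n → 2 ^ r < 2 * n) (sym a+b≡suc-2v)
    (≤-<-trans (least-2^-exceeding-≤-2* (2 * v) r (s≤s z≤n) 1≤r least) (*-monoʳ-< 2 (n<1+n (2 * v))))
  x = 2 ^ r ∸ a
  length≡ : suc x ≡ b + 2 ^ r ∸ 2 * v
  length≡ = sym (begin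
    b + 2 ^ r ∸ 2 * v          ≡⟨ cong (λ n → b + n ∸ 2 * v) (m∸n+n≡m (≤-trans (m≤m+n a b) a+b≤2^r)) ⟨
    b + (x + a) ∸ 2 * v        ≡⟨ cong (_∸ 2 * v) (rearrange b x a) ⟩
    (a + b) + x ∸ 2 * v        ≡⟨ cong (λ n → n + x ∸ 2 * v) a+b≡suc-2v ⟩
    suc (2 * v) + x ∸ 2 * v    ≡⟨ cong (_∸ 2 * v) (+-suc (2 * v) x) ⟨
    2 * v + suc x ∸ 2 * v      ≡⟨ m+n∸m≡n (2 * v) (suc x) ⟩
    suc x                      ∎)
    where
    open ≡-Reasoning
    rearrange : ∀ b x a → b + (x + a) ≡ a + b + x
    rearrange = solve-∀

-- The oddness of u, that v is not a power of 2, and r, t ≥ 1 are not needed: every case is an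
-- instance of ℓ_A = T - a + 1.
proposition3p10 : (a b : ℕ) → 2 ≤ a → 2 ≤ b →
    ((r : ℕ) → 1 ≤ r → a + b ≡ 2 ^ r → LengthIs (Apoly a b) (b + 1))
    × ((r u w : ℕ) → 1 ≤ r → 3 ≤ u → ¬ (2 ∣ u) → a + b ≡ 2 ^ r * u →
    1 ≤ w → u ∸ 1 < 2 ^ w → ((w′ : ℕ) → 1 ≤ w′ → u ∸ 1 < 2 ^ w′ → w ≤ w′) →
    LengthIs (Apoly a b) (b + 2 ^ r * (2 ^ w ∸ u) + 1))
    × ((t : ℕ) → 1 ≤ t → a + b ≡ 2 ^ t + 1 → LengthIs (Apoly a b) (a + 2 * b ∸ 1))
    × ((v r : ℕ) → a + b ≡ 2 * v + 1 → ¬ (∃ λ k → v ≡ 2 ^ k) →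
    1 ≤ r → 2 * v < 2 ^ r → ((r′ : ℕ) → 1 ≤ r′ → 2 * v < 2 ^ r′ → r ≤ r′) →
    LengthIs (Apoly a b) (b + 2 ^ r ∸ 2 * v))
proposition3p10 a b 2≤a 2≤b =
    (λ r _ a+b≡ → Apoly-length-2^r a b r 1≤b a+b≡)
  , (λ r u w _ 3≤u _ a+b≡ 1≤w u∸1<2^w least →
       Apoly-length-2^r*u a b r u w 1≤b 3≤u a+b≡ u∸1<2^w least 1≤w)
  , (λ t _ a+b≡ → Apoly-length-2^t+1 a b t 1≤b a+b≡)
  , (λ v r a+b≡ _ 1≤r 2v<2^r least → Apoly-length-2v+1 a b v r 2≤a 1≤b a+b≡ 2v<2^r least 1≤r)
  where
  1≤b : 1 ≤ b
  1≤b = ≤-trans (s≤s z≤n) 2≤b
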